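{- Let $f$ be a defined function symbol of arity $n$ and $\sigma$ a normalised substitution with $x_1,\dots,x_n\in\mathrm{dom}(\sigma)$. Then there is a value $v$ with $\sigma\vdash f(x_1,\dots,x_n)\Downarrow^{m}v$ if and only if $\mathrm{dh}(f(x_1\sigma,\dots,x_n\sigma),\to)=m$.
   Context: Typed rewriting. $\mathcal{C}$ (constructors) and $\mathcal{D}$ (defined symbols) are disjoint finite sets of function symbols, $S$ a finite set of base types, $\mathcal{V}$ an $S$-sorted set of variables. Every $f$ has a base type declaration; terms respect declarations. Values are ground constructor terms. Substitutions respect types; normalised means the range consists of values. $\sigma\uplus\tau$ is the union of substitutions with disjoint domains. $\mathcal{R}$ is a finite set of typed rules $f(l_1,\dots,l_n)\to r$ with $f\in\mathcal{D}$, $l_i$ built from constructors and variables, $l,r$ of the same type, $\mathrm{Var}(r)\subseteq\mathrm{Var}(l)$; $\mathcal{R}$ is left-linear, non-overlapping and completely defined (every ground normal form is a value). Innermost rewriting: $s\to t$ iff $s=C[l\sigma]$, $t=C[r\sigma]$ for a rule $l\to r$, a context $C$ and a normalised substitution $\sigma$. $\mathrm{dh}(t,\to)$ is the maximal length of a $\to$-derivation starting from $t$. Big-step semantics. Judgements $\sigma\vdash t\Downarrow^{m}v$ are defined by: (i) if $x\sigma=v$ then $\sigma\vdash x\Downarrow^{0}v$; (ii) if $c\in\mathcal{C}$ and $x_i\sigma=v_i$ for all $i$ then $\sigma\vdash c(x_1,\dots,x_n)\Downarrow^{0}c(v_1,\dots,v_n)$; (iii) if $f(l_1,\dots,l_n)\to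 r\in\mathcal{R}$, there is a normalised $\tau$ with $x_i\sigma=l_i\tau$ for all $i$, and $\sigma\uplus\tau\vdash r\Downarrow^{m}v$, then $\sigma\vdash f(x_1,\dots,x_n)\Downarrow^{m+1}v$; (iv) if $x_1,\dots,x_n$ are fresh, $\sigma\vdash t_i\Downarrow^{m_i}v_i$ for all $i$, $\sigma\uplus\rho\vdash f(x_1,\dots,x_n)\Downarrow^{m_0}v$ where $\rho=\{x_1\mapsto v_1,\dots,x_n\mapsto v_n\}$, and $m=\sum_{i=0}^nm_i$, then $\sigma\vdash f(t_1,\dots,t_n)\Downarrow^{m}v$. -}

module Defs where

open import Data.Nat using (ℕ; zero; suc; _+_; _≤_; _<_; _⊔_)
open import Data.Nat.Properties using (≤-trans; m≤m⊔n; m≤n⊔m; <-irrefl)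
import Data.Nat.Properties as ℕP
open import Data.Fin using (Fin)
import Data.Fin.Properties as FinP
open import Data.List using (List; []; _∷_; length)
open import Data.List.Membership.Propositional using (_∈_)
open import Data.List.Relation.Unary.Any using (index)
open import Data.Maybe using (Maybe; just; nothing; fromMaybe; _<∣>_)
open import Data.Product using (Σ; ∃; _×_; _,_; proj₁; proj₂)
open import Data.Sum using (_⊎_; inj₁; inj₂)
open import Data.Unit using (⊤; tt)
open import Data.Empty using (⊥-elim)
open import Data.Bool using (if_then_else_; _∧_)
open import Relation.Nullary using (¬_; yes; no; does)
open import Relation.Binary.PropositionalEquality using (_≡_; refl)

-- Base types S = Fin nS, constructors
-- 𝒞 = Fin nC, defined symbols 𝒟 = Fin nD (disjoint: symbols are 𝒞 ⊎ 𝒟).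

record Signature : Set where
  field
    nS nC nD : ℕ
    cdecl : Fin nC → List (Fin nS) × Fin nS
    ddecl : Fin nD → List (Fin nS) × Fin nS

module Rewriting (sig : Signature) where
  open Signature sig

  Sort : Set
  Sort = Fin nS

  Sym : Set
  Sym = Fin nC ⊎ Fin nD

  decl : Sym → List Sort × Sort
  decl (inj₁ c) = cdecl c
  decl (inj₂ f) = ddecl f

  ar : Sym → List Sort
  ar f = proj₁ (decl f)

  res : Sym → Sort
  res f = proj₂ (decl f)

  -- Variables: the S-sorted set 𝒱 with 𝒱_s = ℕ for each sort s
  -- (a variable is a pair (s , k)).  Terms respect declarations.
  data Term : Sort → Set
  data Terms : List Sort → Set

  data Term where
    var : ∀ {s} → ℕ → Term s
    app : (f : Sym) → Terms (ar f) → Term (res f)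

  data Terms where
    [] : Terms []
    _∷_ : ∀ {s ss} → Term s → Terms ss → Terms (s ∷ ss)

  Env : Set
  Env = (s : Sort) → ℕ → Term s

  _⟨_⟩ : ∀ {s} → Term s → Env → Term s
  _⟨_⟩* : ∀ {ss} → Terms ss → Env → Terms ss
  var {s} x ⟨ θ ⟩ = θ s x
  app f ts ⟨ θ ⟩ = app f (ts ⟨ θ ⟩*)
  [] ⟨ θ ⟩* = []
  (t ∷ ts) ⟨ θ ⟩* = (t ⟨ θ ⟩) ∷ (ts ⟨ θ ⟩*)

  occ : (s : Sort) → ℕ → ∀ {s'} → Term s' → ℕ
  occs : (s : Sort) → ℕ → ∀ {ss} → Terms ss → ℕ
  occ s k {s'} (var x) = if does (s FinP.≟ s') ∧ does (k ℕP.≟ x) then 1 else 0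
  occ s k (app f ts) = occs s k ts
  occs s k [] = 0
  occs s k (t ∷ ts) = occ s k t + occs s k ts

  Ground : ∀ {s} → Term s → Set
  Ground t = ∀ s k → occ s k t ≡ 0

  data IsValue : ∀ {s} → Term s → Set
  data AllValues : ∀ {ss} → Terms ss → Set
  data IsValue where
    con : (c : Fin nC) {ts : Terms (ar (inj₁ c))} → AllValues ts → IsValue (app (inj₁ c) ts)
  data AllValues where
    [] : AllValues []
    _∷_ : ∀ {s ss} {t : Term s} {ts : Terms ss} → IsValue t → AllValues ts → AllValues (t ∷ ts)

  data IsPattern : ∀ {s} → Term s → Set
  data AllPatterns : ∀ {ss} → Terms ss → Set
  data IsPattern where
    var : ∀ {s} (x : ℕ) → IsPattern (var {s} x)
    con : (c : Fin nC) {ts : Terms (ar (inj₁ c))} → AllPatterns ts → IsPattern (app (inj₁ c) ts)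
  data AllPatterns where
    [] : AllPatterns []
    _∷_ : ∀ {s ss} {t : Term s} {ts : Terms ss} → IsPattern t → AllPatterns ts → AllPatterns (t ∷ ts)

  record Subst : Set where
    field
      map : (s : Sort) → ℕ → Maybe (Term s)
      bound : ℕ
      finite : ∀ s k → bound ≤ k → map s k ≡ nothing
  open Subst public

  env : Subst → Env
  env σ s k = fromMaybe (var k) (map σ s k)

  _·_ : ∀ {s} → Term s → Subst → Term s
  t · σ = t ⟨ env σ ⟩

  _·*_ : ∀ {ss} → Terms ss → Subst → Terms ss
  ts ·* σ = ts ⟨ env σ ⟩*

  InDom : Subst → (s : Sort) → ℕ → Set
  InDom σ s k = ∃ λ t → map σ s k ≡ just t

  Normalised : Subst → Set
  Normalised σ = ∀ s k t → map σ s k ≡ just t → IsValue t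

  Disjoint : Subst → Subst → Set
  Disjoint σ τ = ∀ s k → map σ s k ≡ nothing ⊎ map τ s k ≡ nothing

  -- union σ ⊎ τ (used only when the domains are disjoint)
  _⊎ˢ_ : Subst → Subst → Subst
  map (σ ⊎ˢ τ) s k = map σ s k <∣> map τ s k
  bound (σ ⊎ˢ τ) = bound σ ⊔ bound τ
  finite (σ ⊎ˢ τ) s k le
    rewrite finite σ s k (≤-trans (m≤m⊔n (bound σ) (bound τ)) le)
          | finite τ s k (≤-trans (m≤n⊔m (bound σ) (bound τ)) le) = refl

  emptyˢ : Subst
  map emptyˢ _ _ = nothing
  bound emptyˢ = 0
  finite emptyˢ _ _ _ = refl

  sing-map : (s₀ : Sort) → ℕ → Term s₀ → (s : Sort) → ℕ → Maybe (Term s)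
  sing-map s₀ x₀ t₀ s k with s₀ FinP.≟ s | x₀ ℕP.≟ k
  ... | yes refl | yes _ = just t₀
  ... | yes refl | no _ = nothing
  ... | no _ | _ = nothing

  sing-fin : ∀ s₀ x₀ t₀ s k → suc x₀ ≤ k → sing-map s₀ x₀ t₀ s k ≡ nothing
  sing-fin s₀ x₀ t₀ s k le with s₀ FinP.≟ s | x₀ ℕP.≟ k
  ... | yes refl | yes refl = ⊥-elim (<-irrefl refl le)
  ... | yes refl | no _ = refl
  ... | no _ | yes _ = refl
  ... | no _ | no _ = refl

  singleton : ∀ {s₀} → ℕ → Term s₀ → Subst
  map (singleton {s₀} x₀ t₀) = sing-map s₀ x₀ t₀
  bound (singleton x₀ t₀) = suc x₀
  finite (singleton {s₀} x₀ t₀) = sing-fin s₀ x₀ t₀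

  data Vars : List Sort → Set where
    [] : Vars []
    _∷_ : ∀ {s ss} → ℕ → Vars ss → Vars (s ∷ ss)

  vars : ∀ {ss} → Vars ss → Terms ss
  vars [] = []
  vars (x ∷ xs) = var x ∷ vars xs

  bindings : ∀ {ss} → Vars ss → Terms ss → Subst
  bindings [] [] = emptyˢ
  bindings (x ∷ xs) (t ∷ ts) = singleton x t ⊎ˢ bindings xs ts

  data Binds (σ : Subst) : ∀ {ss} → Vars ss → Terms ss → Set where
    [] : Binds σ [] []
    _∷_ : ∀ {s ss x t} {xs : Vars ss} {ts : Terms ss} →
          map σ s x ≡ just t → Binds σ xs ts → Binds σ (x ∷ xs) (t ∷ ts)

  AllInDom : Subst → ∀ {ss} → Vars ss → Set
  AllInDom σ [] = ⊤
  AllInDom σ (_∷_ {s} x xs) = InDom σ s x × AllInDom σ xs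

  NotIn : (s : Sort) → ℕ → ∀ {ss} → Vars ss → Set
  NotIn s k [] = ⊤
  NotIn s k (_∷_ {s'} x xs) = ¬ (s ≡ s' × k ≡ x) × NotIn s k xs

  Fresh : Subst → ∀ {ss} → Vars ss → Set
  Fresh σ [] = ⊤
  Fresh σ (_∷_ {s} x xs) = map σ s x ≡ nothing × NotIn s x xs × Fresh σ xs

  -- sort-respecting injective renamings of variables (to take variants of rules)
  Renaming : Set
  Renaming = (s : Sort) → ℕ → ℕ

  Injective : Renaming → Set
  Injective π = ∀ s a b → π s a ≡ π s b → a ≡ b

  ren : Renaming → Env
  ren π s k = var (π s k)

  record Rule : Set where
    field
      sym : Fin nD
      lhs : Terms (ar (inj₂ sym))
      rhs : Term (res (inj₂ sym))
      lhs-pattern : AllPatterns lhs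
      var-cond : ∀ s k → 0 < occ s k rhs → 0 < occs s k lhs
  open Rule public

  lhsT : (ρ : Rule) → Term (res (inj₂ (sym ρ)))
  lhsT ρ = app (inj₂ (sym ρ)) (lhs ρ)

  LeftLinear : List Rule → Set
  LeftLinear R = ∀ {ρ} → ρ ∈ R → ∀ s k → occs s k (lhs ρ) ≤ 1

  -- For constructor rules, overlaps can only occur at the root.
  NonOverlapping : List Rule → Set
  NonOverlapping R = ∀ {ρ₁ ρ₂} (p : ρ₁ ∈ R) (q : ρ₂ ∈ R) (θ₁ θ₂ : Env) →
    _≡_ {A = Σ Sort Term} (res (inj₂ (sym ρ₁)) , lhsT ρ₁ ⟨ θ₁ ⟩)
                          (res (inj₂ (sym ρ₂)) , lhsT ρ₂ ⟨ θ₂ ⟩) →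
    index p ≡ index q

  module System (R : List Rule) where

    -- innermost rewriting
    data _⟶_ : ∀ {s} → Term s → Term s → Set
    data _⟶*_ : ∀ {ss} → Terms ss → Terms ss → Set
    data _⟶_ where
      root : ∀ {ρ} → ρ ∈ R → (σ : Subst) → Normalised σ → (lhsT ρ · σ) ⟶ (rhs ρ · σ)
      arg : (f : Sym) {ts us : Terms (ar f)} → ts ⟶* us → app f ts ⟶ app f us
    data _⟶*_ where
      here : ∀ {s ss} {t u : Term s} {ts : Terms ss} → t ⟶ u → (t ∷ ts) ⟶* (u ∷ ts)
      there : ∀ {s ss} {t : Term s} {ts us : Terms ss} → ts ⟶* us → (t ∷ ts) ⟶* (t ∷ us)

    data _⟶[_]_ : ∀ {s} → Term s → ℕ → Term s → Set where
      done : ∀ {s} {t : Term s} → t ⟶[ 0 ] t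
      step : ∀ {s n} {t u w : Term s} → t ⟶ u → u ⟶[ n ] w → t ⟶[ suc n ] w

    Dh : ∀ {s} → Term s → ℕ → Set
    Dh t m = (∃ λ u → t ⟶[ m ] u) × (∀ k u → t ⟶[ k ] u → k ≤ m)

    NormalForm : ∀ {s} → Term s → Set
    NormalForm t = ∀ u → ¬ (t ⟶ u)

    CompletelyDefined : Set
    CompletelyDefined = ∀ s (t : Term s) → Ground t → NormalForm t → IsValue t

    data _⊢_⇓[_]_ : ∀ {s} → Subst → Term s → ℕ → Term s → Set
    data _⊢*_⇓[_]_ : ∀ {ss} → Subst → Terms ss → ℕ → Terms ss → Set
    data _⊢_⇓[_]_ where
      ⇓var : ∀ {σ s x} {v : Term s} → map σ s x ≡ just v → σ ⊢ var x ⇓[ 0 ] v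
      ⇓con : ∀ {σ} (c : Fin nC) (xs : Vars (ar (inj₁ c))) {vs} → Binds σ xs vs →
             σ ⊢ app (inj₁ c) (vars xs) ⇓[ 0 ] app (inj₁ c) vs
      ⇓fun : ∀ {σ ρ m v} → ρ ∈ R → (xs : Vars (ar (inj₂ (sym ρ)))) →
             (π : Renaming) → Injective π →
             (τ : Subst) → Normalised τ → Disjoint σ τ →
             Binds σ xs ((lhs ρ ⟨ ren π ⟩*) ·* τ) →
             (σ ⊎ˢ τ) ⊢ (rhs ρ ⟨ ren π ⟩) ⇓[ m ] v →
             σ ⊢ app (inj₂ (sym ρ)) (vars xs) ⇓[ suc m ] v
      ⇓app : ∀ {σ m₀ ms} (f : Sym) {v : Term (res f)} (ts : Terms (ar f)) (xs : Vars (ar f)) {vs} →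
             Fresh σ xs →
             σ ⊢* ts ⇓[ ms ] vs →
             (σ ⊎ˢ bindings xs vs) ⊢ app f (vars xs) ⇓[ m₀ ] v →
             σ ⊢ app f ts ⇓[ m₀ + ms ] v
    data _⊢*_⇓[_]_ where
      [] : ∀ {σ} → σ ⊢* [] ⇓[ 0 ] []
      _∷_ : ∀ {σ s ss m n} {t v : Term s} {ts vs : Terms ss} →
            σ ⊢ t ⇓[ m ] v → σ ⊢* ts ⇓[ n ] vs → σ ⊢* (t ∷ ts) ⇓[ m + n ] (v ∷ vs)

-- Innermost rewriting with a non-overlapping constructor system has the
-- diamond property, so every derivation from a term t to a normal form has
-- the same length n, and no derivation from t is longer: dh(t) is the length
-- of any normalising derivation.  A big-step judgement σ ⊢ t ⇓^m v unfolds
-- into an innermost derivation of length m from tσ to the value v.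
-- Conversely, if tσ normalises within N steps, one evaluates the arguments
-- first and then fires the rule used by the first root step, by induction on
-- N; complete definedness rules out a call that is stuck on values.  Both
-- directions then meet at the uniqueness of normalising lengths.
module Submission where

open import Defs
open import Data.Nat using (ℕ; zero; suc; _+_; _∸_; _≡ᵇ_; _≤_; _<_; _⊔_; z≤n; s≤s; _≤?_; _<?_)
import Data.Nat.Properties as ℕ
open import Data.Fin using (Fin)
import Data.Fin.Properties as Fin
open import Data.List using (List; []; _∷_; lookup)
open import Data.List.Membership.Propositional using (_∈_)
open import Data.List.Relation.Unary.Any using (index)
open import Data.List.Relation.Unary.Any.Properties using (lookup-index)
open import Data.Maybe using (just; nothing; fromMaybe; _<∣>_)
open import Data.Maybe.Properties using (just-injective)
open import Data.Product using (Σ; ∃; ∃₂; _×_; _,_; proj₂)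
open import Data.Sum using (_⊎_; inj₁; inj₂)
open import Data.Unit using (⊤; tt)
open import Data.Bool using (T; true; false)
open import Data.Empty using (⊥-elim)
open import Function.Bundles using (_⇔_; mk⇔)
open import Relation.Nullary using (¬_; yes; no)
open import Relation.Nullary.Decidable using (dec-true)
open import Relation.Binary.PropositionalEquality as ≡
  using (_≡_; refl; trans; cong; cong₂; subst; subst₂)

module TermProperties (sig : Signature) where
  open Signature sig
  open Rewriting sig

  app-injective : ∀ {f} {ts us : Terms (ar f)} → app f ts ≡ app f us → ts ≡ us
  app-injective refl = refl

  ∷-injective : ∀ {s ss} {t u : Term s} {ts us : Terms ss} →
                _≡_ {A = Terms (s ∷ ss)} (t ∷ ts) (u ∷ us) → t ≡ u × ts ≡ us
  ∷-injective refl = refl , refl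

  sorted-injective : ∀ {s} {t u : Term s} → _≡_ {A = Σ Sort Term} (s , t) (s , u) → t ≡ u
  sorted-injective refl = refl

  Occurs : Sort → ℕ → ∀ {s'} → Term s' → Set
  Occurs s k t = 0 < occ s k t

  Occurs* : Sort → ℕ → ∀ {ss} → Terms ss → Set
  Occurs* s k ts = 0 < occs s k ts

  occurs-var : ∀ s x → Occurs s x (var {s} x)
  occurs-var s x rewrite dec-true (s Fin.≟ s) refl | dec-true (x ℕ.≟ x) refl = s≤s z≤n

  occurs-var⁻ : ∀ s k {s'} x → Occurs s k (var {s'} x) → s ≡ s' × k ≡ x
  occurs-var⁻ s k {s'} x p with s Fin.≟ s' | k ≡ᵇ x in k≡ᵇx
  occurs-var⁻ s k x p  | yes s≡s' | true = s≡s' , ℕ.≡ᵇ⇒≡ k x (subst T (≡.sym k≡ᵇx) tt)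
  occurs-var⁻ s k x () | yes _    | false
  occurs-var⁻ s k x () | no _     | _

  occurs-∷ˡ : ∀ {s k s' ss} (t : Term s') (ts : Terms ss) → Occurs s k t → Occurs* s k (t ∷ ts)
  occurs-∷ˡ t ts p = ℕ.<-≤-trans p (ℕ.m≤m+n _ _)

  occurs-∷ʳ : ∀ {s k s' ss} (t : Term s') (ts : Terms ss) → Occurs* s k ts → Occurs* s k (t ∷ ts)
  occurs-∷ʳ t ts p = ℕ.<-≤-trans p (ℕ.m≤n+m _ _)

  occurs-∷⁻ : ∀ s k {s' ss} (t : Term s') (ts : Terms ss) →
              Occurs* s k (t ∷ ts) → Occurs s k t ⊎ Occurs* s k ts
  occurs-∷⁻ s k t ts p with occ s k t
  ... | zero  = inj₂ p
  ... | suc _ = inj₁ (s≤s z≤n)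

  _⨾_ : Env → Env → Env
  (θ₁ ⨾ θ₂) s k = θ₁ s k ⟨ θ₂ ⟩

  ⟨⟩-⨾ : ∀ {s} (t : Term s) θ₁ θ₂ → t ⟨ θ₁ ⟩ ⟨ θ₂ ⟩ ≡ t ⟨ θ₁ ⨾ θ₂ ⟩
  ⟨⟩*-⨾ : ∀ {ss} (ts : Terms ss) θ₁ θ₂ → ts ⟨ θ₁ ⟩* ⟨ θ₂ ⟩* ≡ ts ⟨ θ₁ ⨾ θ₂ ⟩*
  ⟨⟩-⨾ (var x) θ₁ θ₂ = refl
  ⟨⟩-⨾ (app f ts) θ₁ θ₂ = cong (app f) (⟨⟩*-⨾ ts θ₁ θ₂)
  ⟨⟩*-⨾ [] θ₁ θ₂ = refl
  ⟨⟩*-⨾ (t ∷ ts) θ₁ θ₂ = cong₂ _∷_ (⟨⟩-⨾ t θ₁ θ₂) (⟨⟩*-⨾ ts θ₁ θ₂)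

  ⟨⟩-agree : ∀ {s'} (t : Term s') {θ θ' : Env} →
             (∀ s k → Occurs s k t → θ s k ≡ θ' s k) → t ⟨ θ ⟩ ≡ t ⟨ θ' ⟩
  ⟨⟩*-agree : ∀ {ss} (ts : Terms ss) {θ θ' : Env} →
              (∀ s k → Occurs* s k ts → θ s k ≡ θ' s k) → ts ⟨ θ ⟩* ≡ ts ⟨ θ' ⟩*
  ⟨⟩-agree (var {s} x) h = h s x (occurs-var s x)
  ⟨⟩-agree (app f ts) h = cong (app f) (⟨⟩*-agree ts h)
  ⟨⟩*-agree [] h = refl
  ⟨⟩*-agree (t ∷ ts) h =
    cong₂ _∷_ (⟨⟩-agree t λ s k p → h s k (occurs-∷ˡ t ts p))
              (⟨⟩*-agree ts λ s k p → h s k (occurs-∷ʳ t ts p))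

  ⟨⟩-agree⁻ : ∀ {s'} (t : Term s') {θ θ' : Env} →
              t ⟨ θ ⟩ ≡ t ⟨ θ' ⟩ → ∀ s k → Occurs s k t → θ s k ≡ θ' s k
  ⟨⟩*-agree⁻ : ∀ {ss} (ts : Terms ss) {θ θ' : Env} →
               ts ⟨ θ ⟩* ≡ ts ⟨ θ' ⟩* → ∀ s k → Occurs* s k ts → θ s k ≡ θ' s k
  ⟨⟩-agree⁻ (var x) e s k p with occurs-var⁻ s k x p
  ... | refl , refl = e
  ⟨⟩-agree⁻ (app f ts) e = ⟨⟩*-agree⁻ ts (app-injective e)
  ⟨⟩*-agree⁻ (t ∷ ts) e s k p with ∷-injective e | occurs-∷⁻ s k t ts p
  ... | e₁ , _ | inj₁ q = ⟨⟩-agree⁻ t e₁ s k q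
  ... | _ , e₂ | inj₂ q = ⟨⟩*-agree⁻ ts e₂ s k q

  ⟨ren⟩-agree : ∀ {s'} (t : Term s') π {θ θ' : Env} →
                (∀ s k → Occurs s k t → θ s (π s k) ≡ θ' s k) → t ⟨ ren π ⟩ ⟨ θ ⟩ ≡ t ⟨ θ' ⟩
  ⟨ren⟩-agree t π {θ} h = trans (⟨⟩-⨾ t (ren π) θ) (⟨⟩-agree t h)

  ⟨ren⟩*-agree : ∀ {ss} (ts : Terms ss) π {θ θ' : Env} →
                 (∀ s k → Occurs* s k ts → θ s (π s k) ≡ θ' s k) → ts ⟨ ren π ⟩* ⟨ θ ⟩* ≡ ts ⟨ θ' ⟩*
  ⟨ren⟩*-agree ts π {θ} h = trans (⟨⟩*-⨾ ts (ren π) θ) (⟨⟩*-agree ts h)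

  ⟨⟩-value⁻ : ∀ {s'} (t : Term s') θ → IsValue (t ⟨ θ ⟩) → ∀ s k → Occurs s k t → IsValue (θ s k)
  ⟨⟩*-value⁻ : ∀ {ss} (ts : Terms ss) θ → AllValues (ts ⟨ θ ⟩*) → ∀ s k → Occurs* s k ts → IsValue (θ s k)
  ⟨⟩-value⁻ (var x) θ v s k p with occurs-var⁻ s k x p
  ... | refl , refl = v
  ⟨⟩-value⁻ (app f ts) θ (con c vs) = ⟨⟩*-value⁻ ts θ vs
  ⟨⟩*-value⁻ (t ∷ ts) θ (v ∷ vs) s k p with occurs-∷⁻ s k t ts p
  ... | inj₁ q = ⟨⟩-value⁻ t θ v s k q
  ... | inj₂ q = ⟨⟩*-value⁻ ts θ vs s k q

  occurs-⟨⟩⁻ : ∀ {s'} (t : Term s') θ s k → Occurs s k (t ⟨ θ ⟩) →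
               ∃₂ λ s₁ j → Occurs s₁ j t × Occurs s k (θ s₁ j)
  occurs-⟨⟩*⁻ : ∀ {ss} (ts : Terms ss) θ s k → Occurs* s k (ts ⟨ θ ⟩*) →
                ∃₂ λ s₁ j → Occurs* s₁ j ts × Occurs s k (θ s₁ j)
  occurs-⟨⟩⁻ (var {s'} x) θ s k p = s' , x , occurs-var s' x , p
  occurs-⟨⟩⁻ (app f ts) θ = occurs-⟨⟩*⁻ ts θ
  occurs-⟨⟩*⁻ (t ∷ ts) θ s k p with occurs-∷⁻ s k (t ⟨ θ ⟩) (ts ⟨ θ ⟩*) p
  ... | inj₁ q = let s₁ , j , o , o' = occurs-⟨⟩⁻ t θ s k q in s₁ , j , occurs-∷ˡ t ts o , o'
  ... | inj₂ q = let s₁ , j , o , o' = occurs-⟨⟩*⁻ ts θ s k q in s₁ , j , occurs-∷ʳ t ts o , o'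

  value-ground : ∀ {s'} {v : Term s'} → IsValue v → Ground v
  values-ground : ∀ {ss} {vs : Terms ss} → AllValues vs → ∀ s k → occs s k vs ≡ 0
  value-ground (con c vs) = values-ground vs
  values-ground [] s k = refl
  values-ground (v ∷ vs) s k rewrite value-ground v s k | values-ground vs s k = refl

  VarsIn : Subst → ∀ {s} → Term s → Set
  VarsIn σ t = ∀ s k → Occurs s k t → InDom σ s k

  VarsIn* : Subst → ∀ {ss} → Terms ss → Set
  VarsIn* σ ts = ∀ s k → Occurs* s k ts → InDom σ s k

  AllInDom⇒VarsIn* : ∀ {σ ss} (xs : Vars ss) → AllInDom σ xs → VarsIn* σ (vars xs)
  AllInDom⇒VarsIn* (x ∷ xs) (x∈σ , xs∈σ) s k p with occurs-∷⁻ s k (var x) (vars xs) p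
  ... | inj₁ q with occurs-var⁻ s k x q
  ...   | refl , refl = x∈σ
  AllInDom⇒VarsIn* (x ∷ xs) (x∈σ , xs∈σ) s k p | inj₂ q = AllInDom⇒VarsIn* xs xs∈σ s k q

  value⇒InDom : ∀ σ {s k} → IsValue (env σ s k) → InDom σ s k
  value⇒InDom σ {s} {k} v with map σ s k
  value⇒InDom σ v  | just t = t , refl
  value⇒InDom σ () | nothing

  map≡⇒env≡ : ∀ σ₁ σ₂ {s k₁ k₂} → map σ₁ s k₁ ≡ map σ₂ s k₂ → InDom σ₂ s k₂ →
              env σ₁ s k₁ ≡ env σ₂ s k₂
  map≡⇒env≡ σ₁ σ₂ e (t , e₂) = trans (cong (fromMaybe _) (trans e e₂)) (cong (fromMaybe _) (≡.sym e₂))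

  ⊎ˢ-normalised : ∀ σ τ → Normalised σ → Normalised τ → Normalised (σ ⊎ˢ τ)
  ⊎ˢ-normalised σ τ Nσ Nτ s k t e with map σ s k in eq
  ... | just t' = subst IsValue (just-injective e) (Nσ s k t' eq)
  ... | nothing = Nτ s k t e

  ⊎ˢ-missˡ : ∀ σ τ {s k} → map σ s k ≡ nothing → map (σ ⊎ˢ τ) s k ≡ map τ s k
  ⊎ˢ-missˡ σ τ e = cong (_<∣> map τ _ _) e

  ⊎ˢ-envʳ : ∀ σ τ {s k} → Disjoint σ τ → InDom τ s k → env (σ ⊎ˢ τ) s k ≡ env τ s k
  ⊎ˢ-envʳ σ τ {s} {k} D k∈τ with D s k
  ... | inj₁ e = map≡⇒env≡ (σ ⊎ˢ τ) τ (⊎ˢ-missˡ σ τ e) k∈τ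
  ... | inj₂ e with () ← trans (≡.sym e) (proj₂ k∈τ)

  singleton-normalised : ∀ {s₀} x {v : Term s₀} → IsValue v → Normalised (singleton x v)
  singleton-normalised {s₀} x v s k t e with s₀ Fin.≟ s | x ℕ.≟ k
  singleton-normalised x v s k t refl | yes refl | yes _ = v
  singleton-normalised x v s k t ()   | yes refl | no _
  singleton-normalised x v s k t ()   | no _     | _

  singleton-hit : ∀ {s₀} x (v : Term s₀) → map (singleton x v) s₀ x ≡ just v
  singleton-hit {s₀} x v with s₀ Fin.≟ s₀ | x ℕ.≟ x
  ... | yes refl | yes _ = refl
  ... | yes refl | no x≢x = ⊥-elim (x≢x refl)
  ... | no s₀≢s₀ | _ = ⊥-elim (s₀≢s₀ refl)

  singleton-miss : ∀ {s₀} x (v : Term s₀) {s k} → ¬ (s₀ ≡ s × x ≡ k) → map (singleton x v) s k ≡ nothing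
  singleton-miss {s₀} x v {s} {k} ne with s₀ Fin.≟ s | x ℕ.≟ k
  ... | yes refl | yes e = ⊥-elim (ne (refl , e))
  ... | yes refl | no _ = refl
  ... | no _ | _ = refl

  bindings-normalised : ∀ {ss} (xs : Vars ss) {vs} → AllValues vs → Normalised (bindings xs vs)
  bindings-normalised [] [] s k t ()
  bindings-normalised (x ∷ xs) {t ∷ ts} (v ∷ vs) =
    ⊎ˢ-normalised (singleton x t) (bindings xs ts) (singleton-normalised x v) (bindings-normalised xs vs)

  Binds-vars : ∀ {σ ss} {xs : Vars ss} {ts} → Binds σ xs ts → vars xs ·* σ ≡ ts
  Binds-vars [] = refl
  Binds-vars (e ∷ b) = cong₂ _∷_ (cong (fromMaybe _) e) (Binds-vars b)

  Binds-values : ∀ {σ ss} {xs : Vars ss} {ts} → Normalised σ → Binds σ xs ts → AllValues ts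
  Binds-values Nσ [] = []
  Binds-values Nσ (e ∷ b) = Nσ _ _ _ e ∷ Binds-values Nσ b

  Binds-singleton : ∀ {s₀ ss} x (v : Term s₀) {τ} {ys : Vars ss} {vs} →
                    NotIn s₀ x ys → Binds τ ys vs → Binds (singleton x v ⊎ˢ τ) ys vs
  Binds-singleton x v _ [] = []
  Binds-singleton x v {τ} (x∉y , x∉ys) (e ∷ b) =
    trans (⊎ˢ-missˡ (singleton x v) τ (singleton-miss x v x∉y)) e ∷ Binds-singleton x v x∉ys b

  Binds-⊎ˢʳ : ∀ {σ τ ss} {ys : Vars ss} {vs} → Fresh σ ys → Binds τ ys vs → Binds (σ ⊎ˢ τ) ys vs
  Binds-⊎ˢʳ _ [] = []
  Binds-⊎ˢʳ {σ} {τ} (y∉σ , _ , fr) (e ∷ b) = trans (⊎ˢ-missˡ σ τ y∉σ) e ∷ Binds-⊎ˢʳ fr b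

  bindings-Binds : ∀ {σ ss} (ys : Vars ss) {vs} → Fresh σ ys → Binds (bindings ys vs) ys vs
  bindings-Binds [] {[]} _ = []
  bindings-Binds (y ∷ ys) {v ∷ vs} (_ , y∉ys , fr) =
    cong (_<∣> map (bindings ys vs) _ y) (singleton-hit y v)
      ∷ Binds-singleton y v y∉ys (bindings-Binds ys fr)

  fresh-bindings-Binds : ∀ {σ ss} (ys : Vars ss) {vs} → Fresh σ ys → Binds (σ ⊎ˢ bindings ys vs) ys vs
  fresh-bindings-Binds ys fr = Binds-⊎ˢʳ fr (bindings-Binds ys fr)

  varsFrom : ℕ → (ss : List Sort) → Vars ss
  varsFrom b [] = []
  varsFrom b (s ∷ ss) = b ∷ varsFrom (suc b) ss

  varsFrom-NotIn : ∀ s {k b} ss → k < b → NotIn s k (varsFrom b ss)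
  varsFrom-NotIn s [] k<b = tt
  varsFrom-NotIn s (_ ∷ ss) k<b =
    (λ { (_ , refl) → ℕ.<-irrefl refl k<b }) , varsFrom-NotIn s ss (ℕ.m<n⇒m<1+n k<b)

  varsFrom-fresh : ∀ σ {b} ss → bound σ ≤ b → Fresh σ (varsFrom b ss)
  varsFrom-fresh σ [] _ = tt
  varsFrom-fresh σ {b} (s ∷ ss) σ≤b =
    finite σ s b σ≤b , varsFrom-NotIn s ss ℕ.≤-refl , varsFrom-fresh σ ss (ℕ.m≤n⇒m≤1+n σ≤b)

  shift : Subst → ℕ → Subst
  map (shift σ b) s k with b ≤? k
  ... | yes _ = map σ s (k ∸ b)
  ... | no _ = nothing
  bound (shift σ b) = b + bound σ
  finite (shift σ b) s k le with b ≤? k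
  ... | yes _ = finite σ s (k ∸ b) (subst (_≤ k ∸ b) (ℕ.m+n∸m≡n b (bound σ)) (ℕ.∸-monoˡ-≤ b le))
  ... | no _ = refl

  shift-map : ∀ σ b s k → map (shift σ b) s (b + k) ≡ map σ s k
  shift-map σ b s k with b ≤? b + k
  ... | yes _ = cong (map σ s) (ℕ.m+n∸m≡n b k)
  ... | no b≰b+k = ⊥-elim (b≰b+k (ℕ.m≤m+n b k))

  shift-normalised : ∀ σ b → Normalised σ → Normalised (shift σ b)
  shift-normalised σ b Nσ s k t e with b ≤? k
  shift-normalised σ b Nσ s k t e  | yes _ = Nσ s (k ∸ b) t e
  shift-normalised σ b Nσ s k t () | no _

  shift-disjoint : ∀ σ σ' → Disjoint σ (shift σ' (bound σ))
  shift-disjoint σ σ' s k with bound σ ≤? k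
  ... | yes σ≤k = inj₁ (finite σ s k σ≤k)
  ... | no _ = inj₂ refl

  shiftRen : ℕ → Renaming
  shiftRen b _ k = b + k

  shiftRen-injective : ∀ b → Injective (shiftRen b)
  shiftRen-injective b _ = ℕ.+-cancelˡ-≡ b

  ⊎ˢ-shift-map : ∀ σ σ' s k → map (σ ⊎ˢ shift σ' (bound σ)) s (bound σ + k) ≡ map σ' s k
  ⊎ˢ-shift-map σ σ' s k =
    trans (⊎ˢ-missˡ σ (shift σ' (bound σ)) (finite σ s _ (ℕ.m≤m+n _ k))) (shift-map σ' (bound σ) s k)

  maxVar : ∀ {s} → Term s → ℕ
  maxVar* : ∀ {ss} → Terms ss → ℕ
  maxVar (var x) = suc x
  maxVar (app f ts) = maxVar* ts
  maxVar* [] = 0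
  maxVar* (t ∷ ts) = maxVar t ⊔ maxVar* ts

  occurs⇒<maxVar : ∀ {s'} (t : Term s') s {k} → Occurs s k t → k < maxVar t
  occurs⇒<maxVar* : ∀ {ss} (ts : Terms ss) s {k} → Occurs* s k ts → k < maxVar* ts
  occurs⇒<maxVar (var x) s {k} p with occurs-var⁻ s k x p
  ... | refl , refl = ℕ.≤-refl
  occurs⇒<maxVar (app f ts) = occurs⇒<maxVar* ts
  occurs⇒<maxVar* (t ∷ ts) s {k} p with occurs-∷⁻ s k t ts p
  ... | inj₁ q = ℕ.<-≤-trans (occurs⇒<maxVar t s q) (ℕ.m≤m⊔n _ _)
  ... | inj₂ q = ℕ.<-≤-trans (occurs⇒<maxVar* ts s q) (ℕ.m≤n⊔m _ _)

  -- τ ∘ π, cut off at B so that it is again a finite substitution.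
  pullback : Subst → Renaming → ℕ → Subst
  map (pullback τ π B) s k with k <? B
  ... | yes _ = map τ s (π s k)
  ... | no _ = nothing
  bound (pullback τ π B) = B
  finite (pullback τ π B) s k B≤k with k <? B
  ... | yes k<B = ⊥-elim (ℕ.<-irrefl refl (ℕ.<-≤-trans k<B B≤k))
  ... | no _ = refl

  pullback-map : ∀ τ π {B s k} → k < B → map (pullback τ π B) s k ≡ map τ s (π s k)
  pullback-map τ π {B} {s} {k} k<B with k <? B
  ... | yes _ = refl
  ... | no k≮B = ⊥-elim (k≮B k<B)

  pullback-normalised : ∀ τ π B → Normalised τ → Normalised (pullback τ π B)
  pullback-normalised τ π B Nτ s k t e with k <? B
  pullback-normalised τ π B Nτ s k t e  | yes _ = Nτ s (π s k) t e
  pullback-normalised τ π B Nτ s k t () | no _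

module RewritingProperties (sig : Signature) (R : List (Rewriting.Rule sig)) where
  open Signature sig
  open Rewriting sig
  open System R
  open TermProperties sig

  data _⟶*[_]_ : ∀ {ss} → Terms ss → ℕ → Terms ss → Set where
    done : ∀ {ss} {ts : Terms ss} → ts ⟶*[ 0 ] ts
    step : ∀ {ss n} {ts us ws : Terms ss} → ts ⟶* us → us ⟶*[ n ] ws → ts ⟶*[ suc n ] ws

  ⟶[]-trans : ∀ {s m n} {t u w : Term s} → t ⟶[ m ] u → u ⟶[ n ] w → t ⟶[ m + n ] w
  ⟶[]-trans done d = d
  ⟶[]-trans (step st d) d' = step st (⟶[]-trans d d')

  ⟶[]-snoc : ∀ {s n} {t u w : Term s} → t ⟶[ n ] u → u ⟶ w → t ⟶[ suc n ] w
  ⟶[]-snoc done st = step st done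
  ⟶[]-snoc (step st d) st' = step st (⟶[]-snoc d st')

  ⟶*[]-trans : ∀ {ss m n} {ts us ws : Terms ss} → ts ⟶*[ m ] us → us ⟶*[ n ] ws → ts ⟶*[ m + n ] ws
  ⟶*[]-trans done d = d
  ⟶*[]-trans (step st d) d' = step st (⟶*[]-trans d d')

  app-⟶[] : ∀ {f n} {ts us : Terms (ar f)} → ts ⟶*[ n ] us → app f ts ⟶[ n ] app f us
  app-⟶[] done = done
  app-⟶[] (step st d) = step (arg _ st) (app-⟶[] d)

  ∷-⟶*[]ˡ : ∀ {s ss n} {t u : Term s} {ts : Terms ss} → t ⟶[ n ] u → (t ∷ ts) ⟶*[ n ] (u ∷ ts)
  ∷-⟶*[]ˡ done = done
  ∷-⟶*[]ˡ (step st d) = step (here st) (∷-⟶*[]ˡ d)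

  ∷-⟶*[]ʳ : ∀ {s ss n} {t : Term s} {ts us : Terms ss} → ts ⟶*[ n ] us → (t ∷ ts) ⟶*[ n ] (t ∷ us)
  ∷-⟶*[]ʳ done = done
  ∷-⟶*[]ʳ (step st d) = step (there st) (∷-⟶*[]ʳ d)

  NormalForm* : ∀ {ss} → Terms ss → Set
  NormalForm* ts = ∀ us → ¬ (ts ⟶* us)

  value-normal : ∀ {s} {v : Term s} → IsValue v → NormalForm v
  values-normal : ∀ {ss} {vs : Terms ss} → AllValues vs → NormalForm* vs
  value-normal (con c vs) _ (arg _ st) = values-normal vs _ st
  values-normal (v ∷ vs) _ (here st) = value-normal v _ st
  values-normal (v ∷ vs) _ (there st) = values-normal vs _ st

  pattern-normal : ∀ σ {s} {p : Term s} → Normalised σ → IsPattern p → NormalForm (p · σ)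
  patterns-normal : ∀ σ {ss} {ps : Terms ss} → Normalised σ → AllPatterns ps → NormalForm* (ps ·* σ)
  pattern-normal σ {s} Nσ (var x) u st with map σ s x in e
  pattern-normal σ Nσ (var x) u st | just t = value-normal (Nσ _ x t e) u st
  pattern-normal σ Nσ (var x) u () | nothing
  pattern-normal σ Nσ (con c ps) _ (arg _ st) = patterns-normal σ Nσ ps _ st
  patterns-normal σ Nσ (p ∷ ps) _ (here st) = pattern-normal σ Nσ p _ st
  patterns-normal σ Nσ (p ∷ ps) _ (there st) = patterns-normal σ Nσ ps _ st

  dh-normal-form : ∀ {s m} {t : Term s} → Dh t m → ∃ λ u → t ⟶[ m ] u × NormalForm u
  dh-normal-form {m = m} ((u , d) , longest) =
    u , d , λ w st → ℕ.1+n≰n (longest (suc m) w (⟶[]-snoc d st))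

  dh-unique : ∀ {s m n} {t : Term s} → Dh t m → Dh t n → m ≡ n
  dh-unique ((_ , dm) , m-longest) ((_ , dn) , n-longest) =
    ℕ.≤-antisym (n-longest _ _ dm) (m-longest _ _ dn)

  -- The variant f(l₁π,…,lₙπ) → rπ used by rule (iii), instantiated by τ,
  -- is an instance of ρ itself: the matcher is τ ∘ π on the variables of l.
  variant-step : ∀ {ρ} → ρ ∈ R → (xs : Vars (ar (inj₂ (sym ρ)))) (π : Renaming) (σ τ : Subst) →
                 Normalised σ → Normalised τ → Disjoint σ τ → Binds σ xs ((lhs ρ ⟨ ren π ⟩*) ·* τ) →
                 (app (inj₂ (sym ρ)) (vars xs) · σ) ⟶ ((rhs ρ ⟨ ren π ⟩) · (σ ⊎ˢ τ))
  variant-step {ρ} p xs π σ τ Nσ Nτ D b =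
    subst₂ _⟶_ (cong (app _) lhs-eq) rhs-eq (root p (pullback τ π B) (pullback-normalised τ π B Nτ))
    where
    B = maxVar* (lhs ρ)
    lhs-in-dom : ∀ s k → Occurs* s k (lhs ρ) → InDom τ s (π s k)
    lhs-in-dom s k o = value⇒InDom τ (⟨⟩*-value⁻ (lhs ρ) (ren π ⨾ env τ) lπτ-values s k o)
      where
      lπτ-values = subst AllValues (⟨⟩*-⨾ (lhs ρ) (ren π) (env τ)) (Binds-values Nσ b)
    pullback-env : ∀ s k → Occurs* s k (lhs ρ) → env τ s (π s k) ≡ env (pullback τ π B) s k
    pullback-env s k o =
      ≡.sym (map≡⇒env≡ (pullback τ π B) τ (pullback-map τ π (occurs⇒<maxVar* (lhs ρ) s o))
                                           (lhs-in-dom s k o))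
    lhs-eq : lhs ρ ·* pullback τ π B ≡ vars xs ·* σ
    lhs-eq = ≡.sym (trans (Binds-vars b) (⟨ren⟩*-agree (lhs ρ) π pullback-env))
    rhs-eq : rhs ρ · pullback τ π B ≡ (rhs ρ ⟨ ren π ⟩) · (σ ⊎ˢ τ)
    rhs-eq = ≡.sym (⟨ren⟩-agree (rhs ρ) π λ s k o →
      trans (⊎ˢ-envʳ σ τ D (lhs-in-dom s k (var-cond ρ s k o))) (pullback-env s k (var-cond ρ s k o)))

  sound : ∀ {σ s} {t : Term s} {m v} → Normalised σ → σ ⊢ t ⇓[ m ] v → IsValue v × (t · σ) ⟶[ m ] v
  sound* : ∀ {σ ss} {ts : Terms ss} {m vs} → Normalised σ → σ ⊢* ts ⇓[ m ] vs →
           AllValues vs × (ts ·* σ) ⟶*[ m ] vs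
  sound Nσ (⇓var e) rewrite e = Nσ _ _ _ e , done
  sound Nσ (⇓con c xs b) rewrite Binds-vars b = con c (Binds-values Nσ b) , done
  sound {σ} Nσ (⇓fun p xs π _ τ Nτ D b ⇓rhs) =
    let v , rhs⟶v = sound (⊎ˢ-normalised σ τ Nσ Nτ) ⇓rhs
    in v , step (variant-step p xs π σ τ Nσ Nτ D b) rhs⟶v
  sound {σ} Nσ (⇓app {m₀ = m₀} {ms} f {v} ts xs {vs} fr ⇓ts ⇓call) =
    let ivs , ts⟶vs = sound* Nσ ⇓ts
        iv , call⟶v = sound (⊎ˢ-normalised σ (bindings xs vs) Nσ (bindings-normalised xs ivs)) ⇓call
        call⟶v′ = subst (λ z → app f z ⟶[ m₀ ] v) (Binds-vars (fresh-bindings-Binds xs fr)) call⟶v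
    in iv , subst (app f (ts ·* σ) ⟶[_] v) (ℕ.+-comm ms m₀) (⟶[]-trans (app-⟶[] ts⟶vs) call⟶v′)
  sound* Nσ [] = [] , done
  sound* Nσ (⇓t ∷ ⇓ts) =
    let v , t⟶v = sound Nσ ⇓t
        vs , ts⟶vs = sound* Nσ ⇓ts
    in v ∷ vs , ⟶*[]-trans (∷-⟶*[]ˡ t⟶v) (∷-⟶*[]ʳ ts⟶vs)

  module Diamond (NO : NonOverlapping R) where

    data Joinable {s s'} (u : Term s) (u' : Term s') : Set where
      same : _≡_ {A = Σ Sort Term} (s , u) (s' , u') → Joinable u u'
      meet : ∀ {w : Term s} {w' : Term s'} → u ⟶ w → u' ⟶ w' →
             _≡_ {A = Σ Sort Term} (s , w) (s' , w') → Joinable u u'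

    data Joinable* {ss} (us us' : Terms ss) : Set where
      same : us ≡ us' → Joinable* us us'
      meet : ∀ {ws} → us ⟶* ws → us' ⟶* ws → Joinable* us us'

    rule-unique : ∀ {ρ₁ ρ₂} (p : ρ₁ ∈ R) (q : ρ₂ ∈ R) → index p ≡ index q → ρ₁ ≡ ρ₂
    rule-unique p q e = trans (lookup-index p) (trans (cong (lookup R) e) (≡.sym (lookup-index q)))

    -- Stated up to the sort so that two root steps with different rules can be compared.
    diamondΣ : ∀ {s s'} {t u : Term s} {t' u' : Term s'} → t ⟶ u → t' ⟶ u' →
               _≡_ {A = Σ Sort Term} (s , t) (s' , t') → Joinable u u'
    diamond* : ∀ {ss} {ts us us' : Terms ss} → ts ⟶* us → ts ⟶* us' → Joinable* us us'
    diamondΣ (root {ρ₁} p σ₁ _) (root q σ₂ _) e with rule-unique p q (NO p q (env σ₁) (env σ₂) e)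
    ... | refl = same (cong (_ ,_) (⟨⟩-agree (rhs ρ₁) λ s k o →
                   ⟨⟩-agree⁻ (lhsT ρ₁) (sorted-injective e) s k (var-cond ρ₁ s k o)))
    diamondΣ (root {ρ} p σ Nσ) (arg f st) refl = ⊥-elim (patterns-normal σ Nσ (lhs-pattern ρ) _ st)
    diamondΣ (arg f st) (root {ρ} p σ Nσ) refl = ⊥-elim (patterns-normal σ Nσ (lhs-pattern ρ) _ st)
    diamondΣ (arg f st) (arg .f st') refl with diamond* st st'
    ... | same e = same (cong (λ z → res f , app f z) e)
    ... | meet a b = meet (arg f a) (arg f b) refl
    diamond* (here st) (here st') with diamondΣ st st' refl
    ... | same e = same (cong (_∷ _) (sorted-injective e))
    ... | meet a b e = meet (here a) (here (subst (_ ⟶_) (≡.sym (sorted-injective e)) b))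
    diamond* (here st) (there st') = meet (there st') (here st)
    diamond* (there st) (here st') = meet (here st') (there st)
    diamond* (there st) (there st') with diamond* st st'
    ... | same e = same (cong (_ ∷_) e)
    ... | meet a b = meet (there a) (there b)

    diamond : ∀ {s} {t u u' : Term s} → t ⟶ u → t ⟶ u' → u ≡ u' ⊎ ∃ λ w → u ⟶ w × u' ⟶ w
    diamond st st' with diamondΣ st st' refl
    ... | same e = inj₁ (sorted-injective e)
    ... | meet a b e = inj₂ (_ , a , subst (_ ⟶_) (≡.sym (sorted-injective e)) b)

    nf-derivation-step : ∀ {s n} {t u w : Term s} → t ⟶[ n ] w → NormalForm w → t ⟶ u →
                         ∃ λ n' → n ≡ suc n' × u ⟶[ n' ] w
    nf-derivation-step done nf st = ⊥-elim (nf _ st)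
    nf-derivation-step {n = suc n} (step st d) nf st' with diamond st st'
    ... | inj₁ refl = n , refl , d
    ... | inj₂ (_ , a , b) with nf-derivation-step d nf a
    ...   | n' , refl , d' = suc n' , refl , step b d'

    nf-derivation-longest : ∀ {s n k} {t u w : Term s} → t ⟶[ n ] w → NormalForm w → t ⟶[ k ] u → k ≤ n
    nf-derivation-longest d nf done = z≤n
    nf-derivation-longest d nf (step st d') with nf-derivation-step d nf st
    ... | _ , refl , d'' = s≤s (nf-derivation-longest d'' nf d')

    nf-derivation-residual : ∀ {s n k} {t u w : Term s} → t ⟶[ n ] w → NormalForm w →
                             t ⟶[ k ] u → u ⟶[ n ∸ k ] w
    nf-derivation-residual d nf done = d
    nf-derivation-residual d nf (step st d') with nf-derivation-step d nf st
    ... | _ , refl , d'' = nf-derivation-residual d'' nf d'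

    nf-derivation-dh : ∀ {s n} {t w : Term s} → t ⟶[ n ] w → NormalForm w → Dh t n
    nf-derivation-dh d nf = (_ , d) , λ _ _ → nf-derivation-longest d nf

    ⇓⇒dh : ∀ {σ s} {t : Term s} {m v} → Normalised σ → σ ⊢ t ⇓[ m ] v → Dh (t · σ) m
    ⇓⇒dh Nσ ⇓t = let iv , t⟶v = sound Nσ ⇓t in nf-derivation-dh t⟶v (value-normal iv)

  NormalisesWithin : ℕ → ∀ {s} → Term s → Set
  NormalisesWithin N t = ∃₂ λ n w → t ⟶[ n ] w × NormalForm w × n ≤ N

  AllNormaliseWithin : ℕ → ∀ {ss} → Terms ss → Set
  AllNormaliseWithin N [] = ⊤
  AllNormaliseWithin N (t ∷ ts) = NormalisesWithin N t × AllNormaliseWithin N ts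

  normalisesWithin-mono : ∀ {s N N'} {t : Term s} → N ≤ N' → NormalisesWithin N t → NormalisesWithin N' t
  normalisesWithin-mono N≤N' (n , w , d , nf , n≤N) = n , w , d , nf , ℕ.≤-trans n≤N N≤N'

  allNormaliseWithin-mono : ∀ {ss N N'} {ts : Terms ss} → N ≤ N' →
                            AllNormaliseWithin N ts → AllNormaliseWithin N' ts
  allNormaliseWithin-mono {ts = []} _ _ = tt
  allNormaliseWithin-mono {ts = t ∷ ts} N≤N' (t↓ , ts↓) =
    normalisesWithin-mono N≤N' t↓ , allNormaliseWithin-mono N≤N' ts↓

  normal-forms-normalise : ∀ {ss N} {ts : Terms ss} → NormalForm* ts → AllNormaliseWithin N ts
  normal-forms-normalise {ts = []} _ = tt
  normal-forms-normalise {ts = t ∷ ts} nf =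
    (0 , t , done , (λ u st → nf _ (here st)) , z≤n) , normal-forms-normalise (λ us st → nf _ (there st))

  allNormaliseWithin-step : ∀ {ss n} {ts us : Terms ss} → ts ⟶* us →
                            AllNormaliseWithin n us → AllNormaliseWithin (suc n) ts
  allNormaliseWithin-step (here st) ((n , w , d , nf , n≤N) , us↓) =
    (suc n , w , step st d , nf , s≤s n≤N) , allNormaliseWithin-mono (ℕ.n≤1+n _) us↓
  allNormaliseWithin-step (there st) (u↓ , us↓) =
    normalisesWithin-mono (ℕ.n≤1+n _) u↓ , allNormaliseWithin-step st us↓

  -- Steps before the first root step are inside the arguments, and a root
  -- step (being innermost) finds its arguments normal.
  args-normalise : ∀ {f n} {ts : Terms (ar f)} {w} → app f ts ⟶[ n ] w → NormalForm w →
                   AllNormaliseWithin n ts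
  args-normalise done nf = normal-forms-normalise λ us st → nf _ (arg _ st)
  args-normalise (step (root {ρ} p σ Nσ) d) nf =
    normal-forms-normalise (patterns-normal σ Nσ (lhs-pattern ρ))
  args-normalise (step (arg f st) d) nf = allNormaliseWithin-step st (args-normalise d nf)

  Evaluates : Subst → ∀ {s} → Term s → Set
  Evaluates σ t = ∃₂ λ m v → IsValue v × σ ⊢ t ⇓[ m ] v

  Evaluates* : Subst → ∀ {ss} → Terms ss → Set
  Evaluates* σ ts = ∃₂ λ m vs → AllValues vs × σ ⊢* ts ⇓[ m ] vs

  module Completeness (NO : NonOverlapping R) (CD : CompletelyDefined) where
    open Diamond NO

    call-not-normal : ∀ {g : Fin nD} {vs} → AllValues vs → ¬ NormalForm (app (inj₂ g) vs)
    call-not-normal vs nf with CD _ _ (values-ground vs) nf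
    ... | ()

    eval : ∀ N {s} (t : Term s) σ → Normalised σ → VarsIn σ t → NormalisesWithin N (t · σ) → Evaluates σ t
    eval* : ∀ N {ss} (ts : Terms ss) σ → Normalised σ → VarsIn* σ ts →
            AllNormaliseWithin N (ts ·* σ) → Evaluates* σ ts
    evalArgs : ∀ N f (ts : Terms (ar f)) σ → Normalised σ → VarsIn* σ ts → NormalisesWithin N (app f ts · σ) →
               ∃₂ λ ms vs → AllValues vs × σ ⊢* ts ⇓[ ms ] vs × NormalisesWithin N (app f vs)
    evalCall : ∀ N f (xs : Vars (ar f)) σ {vs} → Normalised σ → Binds σ xs vs → AllValues vs →
               NormalisesWithin N (app f vs) → Evaluates σ (app f (vars xs))
    evalRule : ∀ N {ρ} → ρ ∈ R → (xs : Vars (ar (inj₂ (sym ρ)))) (σ σ' : Subst) →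
               Normalised σ → Normalised σ' → Binds σ xs (lhs ρ ·* σ') → NormalisesWithin N (rhs ρ · σ') →
               Evaluates σ (app (inj₂ (sym ρ)) (vars xs))

    eval N (var {s} x) σ Nσ xs∈σ _ = let v , e = xs∈σ s x (occurs-var s x) in 0 , v , Nσ s x v e , ⇓var e
    eval N (app f ts) σ Nσ ts∈σ app↓ =
      let ms , vs , ivs , ⇓ts , call↓ = evalArgs N f ts σ Nσ ts∈σ app↓
          ys = varsFrom (bound σ) (ar f)
          fr = varsFrom-fresh σ (ar f) ℕ.≤-refl
          σ+ys = ⊎ˢ-normalised σ (bindings ys vs) Nσ (bindings-normalised ys ivs)
          m₀ , v , iv , ⇓call = evalCall N f ys _ σ+ys (fresh-bindings-Binds ys fr) ivs call↓
      in m₀ + ms , v , iv , ⇓app f ts ys fr ⇓ts ⇓call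

    eval* N [] σ Nσ _ _ = 0 , [] , [] , []
    eval* N (t ∷ ts) σ Nσ ts∈σ (t↓ , ts↓) =
      let m , v , iv , ⇓t = eval N t σ Nσ (λ s k o → ts∈σ s k (occurs-∷ˡ t ts o)) t↓
          ms , vs , ivs , ⇓ts = eval* N ts σ Nσ (λ s k o → ts∈σ s k (occurs-∷ʳ t ts o)) ts↓
      in m + ms , v ∷ vs , iv ∷ ivs , ⇓t ∷ ⇓ts

    -- After evaluating the arguments to vs, the rest of the normalising
    -- derivation of f(ts)σ continues from f(vs), by the diamond property.
    evalArgs N f ts σ Nσ ts∈σ (n , w , d , nf , n≤N) =
      let ms , vs , ivs , ⇓ts = eval* N ts σ Nσ ts∈σ (allNormaliseWithin-mono n≤N (args-normalise d nf))
          _ , ts⟶vs = sound* Nσ ⇓ts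
          call⟶w = nf-derivation-residual d nf (app-⟶[] ts⟶vs)
      in ms , vs , ivs , ⇓ts , (n ∸ ms , w , call⟶w , nf , ℕ.≤-trans (ℕ.m∸n≤m n ms) n≤N)

    evalCall N (inj₁ c) xs σ Nσ b vs _ = 0 , _ , con c vs , ⇓con c xs b
    evalCall N (inj₂ g) xs σ Nσ b vs (_ , _ , done , nf , _) = ⊥-elim (call-not-normal vs nf)
    evalCall N (inj₂ g) xs σ Nσ b vs (_ , _ , step (arg _ st) _ , _ , _) = ⊥-elim (values-normal vs _ st)
    evalCall (suc N) (inj₂ _) xs σ Nσ b _ (suc n , w , step (root p σ' Nσ') d , nf , s≤s n≤N) =
      evalRule N p xs σ σ' Nσ Nσ' b (n , w , d , nf , n≤N)

    -- The matcher σ' is shifted above dom(σ), which makes the variant fresh.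
    evalRule N {ρ} p xs σ σ' Nσ Nσ' b rhs↓ =
      let m , v , iv , ⇓rhs = eval N (rhs ρ ⟨ ren π ⟩) (σ ⊎ˢ τ) (⊎ˢ-normalised σ τ Nσ Nτ) rhs-vars
                                  (subst (NormalisesWithin N) (≡.sym rhs-eq) rhs↓)
      in suc m , v , iv ,
         ⇓fun p xs π (shiftRen-injective (bound σ)) τ Nτ (shift-disjoint σ σ')
              (subst (Binds σ xs) lhs-eq b) ⇓rhs
      where
      π = shiftRen (bound σ)
      τ = shift σ' (bound σ)
      Nτ = shift-normalised σ' (bound σ) Nσ'
      lhs-in-dom : ∀ s k → Occurs* s k (lhs ρ) → InDom σ' s k
      lhs-in-dom s k o = value⇒InDom σ' (⟨⟩*-value⁻ (lhs ρ) (env σ') (Binds-values Nσ b) s k o)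
      lhs-eq : lhs ρ ·* σ' ≡ (lhs ρ ⟨ ren π ⟩*) ·* τ
      lhs-eq = ≡.sym (⟨ren⟩*-agree (lhs ρ) π λ s k o →
        map≡⇒env≡ τ σ' (shift-map σ' (bound σ) s k) (lhs-in-dom s k o))
      rhs-eq : (rhs ρ ⟨ ren π ⟩) · (σ ⊎ˢ τ) ≡ rhs ρ · σ'
      rhs-eq = ⟨ren⟩-agree (rhs ρ) π λ s k o →
        map≡⇒env≡ (σ ⊎ˢ τ) σ' (⊎ˢ-shift-map σ σ' s k) (lhs-in-dom s k (var-cond ρ s k o))
      rhs-vars : VarsIn (σ ⊎ˢ τ) (rhs ρ ⟨ ren π ⟩)
      rhs-vars s k o with occurs-⟨⟩⁻ (rhs ρ) (ren π) s k o
      ... | _ , j , o₁ , o₂ with occurs-var⁻ s k _ o₂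
      ...   | refl , refl =
        let t , e = lhs-in-dom s j (var-cond ρ s j o₁) in t , trans (⊎ˢ-shift-map σ σ' s j) e

    dh⇒⇓ : ∀ {σ s} {t : Term s} {m} → Normalised σ → VarsIn σ t → Dh (t · σ) m →
           ∃ λ v → IsValue v × σ ⊢ t ⇓[ m ] v
    dh⇒⇓ {σ} {t = t} {m} Nσ t∈σ dh =
      let u , t⟶u , nf = dh-normal-form dh
          _ , v , iv , ⇓t = eval m t σ Nσ t∈σ (m , u , t⟶u , nf , ℕ.≤-refl)
      in v , iv , subst (σ ⊢ t ⇓[_] v) (dh-unique (⇓⇒dh Nσ ⇓t) dh) ⇓t

proposition1 : (sig : Signature) → let open Signature sig in let open Rewriting sig in
    (R : List Rule) → let open System R in
    LeftLinear R → NonOverlapping R → CompletelyDefined →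
    (f : Fin nD) (σ : Subst) → Normalised σ →
    (xs : Vars (ar (inj₂ f))) → AllInDom σ xs → (m : ℕ) →
    (∃ λ v → IsValue v × σ ⊢ app (inj₂ f) (vars xs) ⇓[ m ] v)
      ⇔ Dh (app (inj₂ f) (vars xs) · σ) m
proposition1 sig R _ NO CD f σ Nσ xs xs∈σ m =
  mk⇔ (λ (_ , _ , ⇓call) → ⇓⇒dh Nσ ⇓call) (dh⇒⇓ Nσ (AllInDom⇒VarsIn* xs xs∈σ))
  where
  open TermProperties sig
  open RewritingProperties sig R
  open Diamond NO
  open Completeness NO CD
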